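{- Let $k\ge 2$ and $n\ge 2k+1$ be integers, and define $$q_0(n,k):= \left\lfloor\frac{(k-1)(n-2k+1)}{n-k}+ \frac{(k-1)(n-2k)(n-1)\left(\binom{n-2}{k-1}-\binom{n-k-1}{k-1}\right)}{k(n-k)\left(\binom{n-k-1}{k-1}-1\right)}\right\rfloor.$$ Then $q_0(n,k)<4^k(n-2k)$. -}

module Defs where

open import Data.Nat using (ℕ; zero; suc; _+_; _*_; _∸_)
open import Data.Nat.Combinatorics using (_C_)
open import Data.Integer using (ℤ; +_)
open import Data.Rational using (ℚ; _/_; floor)
import Data.Rational as ℚ

-- x / y as a rational, for natural numbers x, y.
-- Convention: a zero denominator yields 0 (never happens under the
-- hypotheses k ≥ 2, n ≥ 2k+1, where all denominators are positive).
frac : ℕ → ℕ → ℚ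
frac x zero    = ℚ.0ℚ
frac x (suc y) = (+ x) / suc y

-- q₀(n,k) = ⌊ (k-1)(n-2k+1)/(n-k)
--           + (k-1)(n-2k)(n-1)(C(n-2,k-1) - C(n-k-1,k-1))
--             / (k (n-k) (C(n-k-1,k-1) - 1)) ⌋
-- Truncated subtraction ∸ agrees with real subtraction here, since all
-- differences are non-negative under the hypotheses.
q₀ : ℕ → ℕ → ℤ
q₀ n k = floor
  (frac ((k ∸ 1) * (n ∸ 2 * k + 1)) (n ∸ k)
   ℚ.+
   frac ((k ∸ 1) * (n ∸ 2 * k) * (n ∸ 1)
           * (((n ∸ 2) C (k ∸ 1)) ∸ ((n ∸ k ∸ 1) C (k ∸ 1))))
        (k * (n ∸ k) * (((n ∸ k ∸ 1) C (k ∸ 1)) ∸ 1)))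

{-# OPTIONS --safe #-}
-- Write k = r + 1 and n = 2k + m, so that the binomial coefficients in q₀ are
-- A = C(m+2r, r) and B = C(m+r, r).  By the absorption identity the ratio A/B does
-- not increase with m, so it is at most its value C(2r+1, r)/(r+1) ≤ 2^(2r+1)/(r+1)
-- at m = 1; that is, 2(r+1)A ≤ 4^k B.  Together with B ≥ 2 this bounds the second
-- fraction of q₀ by 2rm4^k/k², the first fraction is below r, and
-- r + 2rm4^k/k² ≤ 4^k m because 4^k ≥ k + 1.
module Submission where

open import Defs
open import Data.Nat using (ℕ; _+_; _*_; _∸_; _^_; _≤_)
open import Data.Integer using (+_) renaming (_<_ to _<ℤ_)
open import Data.Nat
  using (zero; suc; _<_; _>_; z≤n; s≤s; z<s; s<s; _!; NonZero; >-nonZero; >-nonZero⁻¹; ≢-nonZero⁻¹)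
open import Data.Nat.Properties
open import Data.Nat.Combinatorics
  using (_C_; nCk≡n!/k![n-k]!; k![n∸k]!∣n!; nCk+nC[k+1]≡[n+1]C[k+1]; nCk≡nC[n∸k]; nC1≡n)
open import Data.Nat.DivMod using (_/_; m/n*n≡m)
open import Data.Nat.Tactic.RingSolver using (solve-∀; solve)
open import Algebra.Properties.CommutativeSemigroup *-commutativeSemigroup using (xy∙z≈y∙xz; xy∙z≈xz∙y)
import Data.Integer as ℤ
import Data.Integer.Properties as ℤ
open import Data.Integer.DivMod using (div-pos-is-/ℕ; [n/ℕd]*d≤n)
open import Data.Rational as ℚ using (mkℚ; toℚᵘ; floor)
import Data.Rational.Properties as ℚ
open import Data.Rational.Unnormalised as ℚᵘ using (mkℚᵘ; *<*)
import Data.Rational.Unnormalised.Properties as ℚᵘ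
open import Data.List using ([]; _∷_)
open import Data.Product using (_,_)
open import Relation.Binary.PropositionalEquality

nCk*k!*[n∸k]!≡n! : ∀ {n k} → k ≤ n → (n C k) * (k ! * (n ∸ k) !) ≡ n !
nCk*k!*[n∸k]!≡n! {n} {k} k≤n = begin
  (n C k) * (k ! * (n ∸ k) !)                  ≡⟨ cong (_* (k ! * (n ∸ k) !)) (nCk≡n!/k![n-k]! k≤n) ⟩
  n ! / (k ! * (n ∸ k) !) * (k ! * (n ∸ k) !)  ≡⟨ m/n*n≡m (k![n∸k]!∣n! k≤n) ⟩
  n !                                          ∎
  where
  open ≡-Reasoning
  instance
    k!*[n∸k]!≢0 : NonZero (k ! * (n ∸ k) !)
    k!*[n∸k]!≢0 = k !* (n ∸ k) !≢0

nCk>0 : ∀ {n k} → k ≤ n → n C k > 0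
nCk>0 {n} {k} k≤n = n≢0⇒n>0 λ nCk≡0 →
  ≢-nonZero⁻¹ (n !) {{n !≢0}}
    (trans (sym (nCk*k!*[n∸k]!≡n! k≤n)) (cong (_* (k ! * (n ∸ k) !)) nCk≡0))

2≤nCk : ∀ {n k} → k > 0 → k < n → 2 ≤ n C k
2≤nCk {suc n} {suc k} _ (s<s k<n) =
  subst (2 ≤_) (nCk+nC[k+1]≡[n+1]C[k+1] n k) (+-mono-≤ (nCk>0 (<⇒≤ k<n)) (nCk>0 k<n))

nCk≤2^n : ∀ n k → n C k ≤ 2 ^ n
nCk≤2^n zero    zero    = ≤-refl
nCk≤2^n zero    (suc k) = z≤n
nCk≤2^n (suc n) zero    = m^n>0 2 (suc n)
nCk≤2^n (suc n) (suc k) = begin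
  suc n C suc k      ≡⟨ nCk+nC[k+1]≡[n+1]C[k+1] n k ⟨
  n C k + n C suc k  ≤⟨ +-mono-≤ (nCk≤2^n n k) (nCk≤2^n n (suc k)) ⟩
  2 ^ n + 2 ^ n      ≡⟨ cong (_+_ (2 ^ n)) (+-identityʳ (2 ^ n)) ⟨
  2 ^ suc n          ∎
  where open ≤-Reasoning

[1+r]Cr≡1+r : ∀ r → suc r C r ≡ suc r
[1+r]Cr≡1+r r = begin
  suc r C r            ≡⟨ nCk≡nC[n∸k] (n≤1+n r) ⟩
  suc r C (suc r ∸ r)  ≡⟨ cong (suc r C_) (m+n∸n≡m 1 r) ⟩
  suc r C 1            ≡⟨ nC1≡n (suc r) ⟩
  suc r                ∎
  where open ≡-Reasoning

[s+r]Cr*r!*s!≡[s+r]! : ∀ s r → ((s + r) C r) * (r ! * s !) ≡ (s + r) !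
[s+r]Cr*r!*s!≡[s+r]! s r = begin
  ((s + r) C r) * (r ! * s !)            ≡⟨ cong (λ t → ((s + r) C r) * (r ! * t !)) (m+n∸n≡m s r) ⟨
  ((s + r) C r) * (r ! * (s + r ∸ r) !)  ≡⟨ nCk*k!*[n∸k]!≡n! (m≤n+m r s) ⟩
  (s + r) !                              ∎
  where open ≡-Reasoning

[1+s]*[1+s+r]Cr≡[1+s+r]*[s+r]Cr : ∀ s r → suc s * (suc (s + r) C r) ≡ suc (s + r) * ((s + r) C r)
[1+s]*[1+s+r]Cr≡[1+s+r]*[s+r]Cr s r = *-cancelʳ-≡ _ _ (r ! * s !) {{r !* s !≢0}} (begin
  suc s * B′ * (r ! * s !)          ≡⟨ rearrange (suc s) B′ (r !) (s !) ⟩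
  B′ * (r ! * (suc s * s !))        ≡⟨ [s+r]Cr*r!*s!≡[s+r]! (suc s) r ⟩
  suc (s + r) * (s + r) !           ≡⟨ cong (suc (s + r) *_) ([s+r]Cr*r!*s!≡[s+r]! s r) ⟨
  suc (s + r) * (B * (r ! * s !))   ≡⟨ *-assoc (suc (s + r)) B (r ! * s !) ⟨
  suc (s + r) * B * (r ! * s !)     ∎)
  where
  open ≡-Reasoning
  B B′ : ℕ
  B  = (s + r) C r
  B′ = suc (s + r) C r
  rearrange : ∀ a b c d → a * b * (c * d) ≡ b * (c * (a * d))
  rearrange = solve-∀

A′*B≤A*B′ : ∀ A A′ B B′ u v w .{{_ : NonZero (u * v)}} →
  u * A′ ≡ w * A → v * B′ ≡ u * B → w * v ≤ u * u → A′ * B ≤ A * B′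
A′*B≤A*B′ A A′ B B′ u v w uA′≡wA vB′≡uB wv≤uu = *-cancelʳ-≤ _ _ (u * v) (begin
  A′ * B * (u * v)  ≡⟨ solve (A′ ∷ B ∷ u ∷ v ∷ []) ⟩
  u * A′ * B * v    ≡⟨ cong (λ t → t * B * v) uA′≡wA ⟩
  w * A * B * v     ≡⟨ solve (w ∷ A ∷ B ∷ v ∷ []) ⟩
  A * B * (w * v)   ≤⟨ *-monoʳ-≤ (A * B) wv≤uu ⟩
  A * B * (u * u)   ≡⟨ solve (A ∷ B ∷ u ∷ []) ⟩
  A * u * (u * B)   ≡⟨ cong (A * u *_) vB′≡uB ⟨
  A * u * (v * B′)  ≡⟨ solve (A ∷ u ∷ v ∷ B′ ∷ []) ⟩
  A * B′ * (u * v)  ∎)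
  where open ≤-Reasoning

[1+s+2r]Cr*[s+r]Cr≤[s+2r]Cr*[1+s+r]Cr : ∀ s r →
  ((suc s + r + r) C r) * ((s + r) C r) ≤ ((s + r + r) C r) * ((suc s + r) C r)
[1+s+2r]Cr*[s+r]Cr≤[s+2r]Cr*[1+s+r]Cr s r = A′*B≤A*B′ A A′ B B′ u v w
  ([1+s]*[1+s+r]Cr≡[1+s+r]*[s+r]Cr (s + r) r)
  ([1+s]*[1+s+r]Cr≡[1+s+r]*[s+r]Cr s r)
  (≤-trans (m≤m+n (w * v) (r * r)) (≤-reflexive (square s r)))
  where
  A A′ B B′ u v w : ℕ
  A  = (s + r + r) C r
  A′ = (suc s + r + r) C r
  B  = (s + r) C r
  B′ = (suc s + r) C r
  u  = suc (s + r)
  v  = suc s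
  w  = suc (s + r + r)
  square : ∀ s r → suc (s + r + r) * suc s + r * r ≡ suc (s + r) * suc (s + r)
  square = solve-∀

2*[1+2r]Cr≤4^[1+r] : ∀ r → 2 * (suc (r + r) C r) ≤ 4 ^ suc r
2*[1+2r]Cr≤4^[1+r] r = begin
  2 * (suc (r + r) C r)   ≤⟨ *-monoʳ-≤ 2 (nCk≤2^n (suc (r + r)) r) ⟩
  2 ^ suc (suc (r + r))   ≡⟨ cong (2 ^_) (2*[1+r]≡2+2r r) ⟨
  2 ^ (2 * suc r)         ≡⟨ ^-*-assoc 2 2 (suc r) ⟨
  4 ^ suc r               ∎
  where
  open ≤-Reasoning
  2*[1+r]≡2+2r : ∀ r → 2 * suc r ≡ suc (suc (r + r))
  2*[1+r]≡2+2r = solve-∀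

2*[1+r]*[1+m+2r]Cr≤4^[1+r]*[1+m+r]Cr : ∀ r m →
  2 * suc r * ((suc m + r + r) C r) ≤ 4 ^ suc r * ((suc m + r) C r)
2*[1+r]*[1+m+2r]Cr≤4^[1+r]*[1+m+r]Cr r zero = begin
  2 * suc r * (suc (r + r) C r)    ≡⟨ xy∙z≈y∙xz 2 (suc r) (suc (r + r) C r) ⟩
  suc r * (2 * (suc (r + r) C r))  ≤⟨ *-monoʳ-≤ (suc r) (2*[1+2r]Cr≤4^[1+r] r) ⟩
  suc r * 4 ^ suc r                ≡⟨ *-comm (suc r) (4 ^ suc r) ⟩
  4 ^ suc r * suc r                ≡⟨ cong (4 ^ suc r *_) ([1+r]Cr≡1+r r) ⟨
  4 ^ suc r * (suc r C r)          ∎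
  where open ≤-Reasoning
2*[1+r]*[1+m+2r]Cr≤4^[1+r]*[1+m+r]Cr r (suc m) =
  *-cancelʳ-≤ _ _ B {{>-nonZero (nCk>0 (m≤n+m r (suc m)))}} (begin
    c * A′ * B    ≡⟨ *-assoc c A′ B ⟩
    c * (A′ * B)  ≤⟨ *-monoʳ-≤ c ([1+s+2r]Cr*[s+r]Cr≤[s+2r]Cr*[1+s+r]Cr (suc m) r) ⟩
    c * (A * B′)  ≡⟨ *-assoc c A B′ ⟨
    c * A * B′    ≤⟨ *-monoˡ-≤ B′ (2*[1+r]*[1+m+2r]Cr≤4^[1+r]*[1+m+r]Cr r m) ⟩
    P * B * B′    ≡⟨ xy∙z≈xz∙y P B B′ ⟩
    P * B′ * B    ∎)
  where
  open ≤-Reasoning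
  c P A A′ B B′ : ℕ
  c  = 2 * suc r
  P  = 4 ^ suc r
  A  = (suc m + r + r) C r
  A′ = (suc (suc m) + r + r) C r
  B  = (suc m + r) C r
  B′ = (suc (suc m) + r) C r

2+n≤4^[1+n] : ∀ n → 2 + n ≤ 4 ^ suc n
2+n≤4^[1+n] zero    = s≤s (s≤s z≤n)
2+n≤4^[1+n] (suc n) = begin
  3 + n            ≤⟨ s≤s (2+n≤4^[1+n] n) ⟩
  1 + X            ≡⟨ +-comm 1 X ⟩
  X + 1            ≤⟨ +-monoʳ-≤ X (≤-trans (m^n>0 4 (suc n)) (m≤n*m X 3)) ⟩
  X + 3 * X        ≡⟨⟩
  4 ^ suc (suc n)  ∎
  where
  open ≤-Reasoning
  X : ℕ
  X = 4 ^ suc n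

c*[A∸B]≤P*[B∸1] : ∀ {c A B P} → 2 ≤ B → 2 * c * A ≤ P * B → c * (A ∸ B) ≤ P * (B ∸ 1)
c*[A∸B]≤P*[B∸1] {c} {A} {B@(suc (suc t))} {P} (s≤s (s≤s _)) 2cA≤PB = *-cancelˡ-≤ 2 (begin
  2 * (c * (A ∸ B))  ≡⟨ *-assoc 2 c (A ∸ B) ⟨
  2 * c * (A ∸ B)    ≤⟨ *-monoʳ-≤ (2 * c) (m∸n≤m A B) ⟩
  2 * c * A          ≤⟨ 2cA≤PB ⟩
  P * B              ≤⟨ *-monoʳ-≤ P (m≤m+n B t) ⟩
  P * (B + t)        ≡⟨ solve (P ∷ t ∷ []) ⟩
  2 * (P * suc t)    ∎)
  where open ≤-Reasoning

r*[1+r]²+2*r*m*P≤P*m*[1+r]² : ∀ r m P .{{_ : NonZero m}} → 2 + r ≤ P →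
  r * (suc r * suc r) + 2 * r * m * P ≤ P * m * (suc r * suc r)
r*[1+r]²+2*r*m*P≤P*m*[1+r]² r m P 2+r≤P = begin
  r * (suc r * suc r) + 2 * r * m * P      ≤⟨ +-monoˡ-≤ (2 * r * m * P) (m≤m+n (r * (suc r * suc r)) 2) ⟩
  r * (suc r * suc r) + 2 + 2 * r * m * P  ≡⟨ solve (r ∷ m ∷ P ∷ []) ⟩
  (2 + r) * (r * r + 1) + 2 * r * m * P    ≤⟨ +-monoˡ-≤ (2 * r * m * P) (*-monoˡ-≤ (r * r + 1) 2+r≤P) ⟩
  P * (r * r + 1) + 2 * r * m * P          ≤⟨ +-monoˡ-≤ (2 * r * m * P) (*-monoˡ-≤ (r * r + 1) (m≤m*n P m)) ⟩
  P * m * (r * r + 1) + 2 * r * m * P      ≡⟨ solve (r ∷ m ∷ P ∷ []) ⟩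
  P * m * (suc r * suc r)                  ∎
  where open ≤-Reasoning

-- a/b < x and c/d ≤ z/y and x + z/y ≤ N give a/b + c/d < N, cross-multiplied.
a*d+c*b<N*[b*d] : ∀ {a b c d x y z N} .{{_ : NonZero d}} .{{_ : NonZero y}} →
  a < x * b → c * y ≤ z * d → x * y + z ≤ N * y → a * d + c * b < N * (b * d)
a*d+c*b<N*[b*d] {a} {b} {c} {d} {x} {y} {z} {N} a<xb cy≤zd xy+z≤Ny = *-cancelʳ-< y _ _ (begin-strict
  (a * d + c * b) * y        ≡⟨ solve (a ∷ b ∷ c ∷ d ∷ y ∷ []) ⟩
  a * d * y + c * y * b      <⟨ +-mono-<-≤ (*-monoˡ-< y (*-monoˡ-< d a<xb)) (*-monoˡ-≤ b cy≤zd) ⟩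
  x * b * d * y + z * d * b  ≡⟨ solve (b ∷ d ∷ x ∷ y ∷ z ∷ []) ⟩
  b * d * (x * y + z)        ≤⟨ *-monoʳ-≤ (b * d) xy+z≤Ny ⟩
  b * d * (N * y)            ≡⟨ solve (b ∷ d ∷ y ∷ N ∷ []) ⟩
  N * (b * d) * y            ∎)
  where open ≤-Reasoning

floor-< : ∀ p i → toℚᵘ p ℚᵘ.< i ℚᵘ./ 1 → floor p <ℤ i
floor-< p@(mkℚ n d-1 _) i (*<* n*1<i*d) = ℤ.*-cancelʳ-<-nonNeg d (begin-strict
  floor p ℤ.* d           ≡⟨ cong (ℤ._* d) (div-pos-is-/ℕ n (suc d-1)) ⟩
  (n ℤ./ℕ suc d-1) ℤ.* d  ≤⟨ [n/ℕd]*d≤n n (suc d-1) ⟩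
  n                       ≡⟨ ℤ.*-identityʳ n ⟨
  n ℤ.* + 1               <⟨ n*1<i*d ⟩
  i ℤ.* d                 ∎)
  where
  open ℤ.≤-Reasoning
  d : ℤ.ℤ
  d = + suc d-1

floor[a/b+c/d]<N : ∀ a b c d N .{{_ : NonZero b}} .{{_ : NonZero d}} →
  a * d + c * b < N * (b * d) → floor (frac a b ℚ.+ frac c d) <ℤ + N
floor[a/b+c/d]<N a (suc b) c (suc d) N ad+cb<N[bd] =
  floor-< _ (+ N) (ℚᵘ.<-respˡ-≃ (ℚᵘ.≃-sym toℚᵘ-sum) (*<* cross-multiplied))
  where
  open ℤ.≤-Reasoning
  toℚᵘ-sum : toℚᵘ (frac a (suc b) ℚ.+ frac c (suc d)) ℚᵘ.≃ mkℚᵘ (+ a) b ℚᵘ.+ mkℚᵘ (+ c) d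
  toℚᵘ-sum = ℚᵘ.≃-trans (ℚ.toℚᵘ-homo-+ (frac a (suc b)) (frac c (suc d)))
                        (ℚᵘ.+-cong (ℚ.toℚᵘ-fromℚᵘ (mkℚᵘ (+ a) b)) (ℚ.toℚᵘ-fromℚᵘ (mkℚᵘ (+ c) d)))
  cross-multiplied : (+ a ℤ.* + suc d ℤ.+ + c ℤ.* + suc b) ℤ.* + 1 <ℤ + N ℤ.* + (suc b * suc d)
  cross-multiplied = begin-strict
    (+ a ℤ.* + suc d ℤ.+ + c ℤ.* + suc b) ℤ.* + 1  ≡⟨ ℤ.*-identityʳ _ ⟩
    + a ℤ.* + suc d ℤ.+ + c ℤ.* + suc b            ≡⟨ cong₂ ℤ._+_ (ℤ.pos-* a (suc d)) (ℤ.pos-* c (suc b)) ⟨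
    + (a * suc d) ℤ.+ + (c * suc b)                ≡⟨ ℤ.pos-+ (a * suc d) (c * suc b) ⟨
    + (a * suc d + c * suc b)                      <⟨ ℤ.+<+ ad+cb<N[bd] ⟩
    + (N * (suc b * suc d))                        ≡⟨ ℤ.pos-* N (suc b * suc d) ⟩
    + N ℤ.* + (suc b * suc d)                      ∎

q : ℕ → ℕ → ℕ → ℕ → ℤ.ℤ
q r m A B = floor (frac (r * (m + 1)) (suc (m + r))
                   ℚ.+ frac (r * m * suc (m + r + r) * (A ∸ B)) (suc r * suc (m + r) * (B ∸ 1)))

q₀≡q : ∀ {n} r m → n ≡ 2 * suc r + m → q₀ n (suc r) ≡ q r m ((m + r + r) C r) ((m + r) C r)
q₀≡q {n} r m n≡2k+m = substitute n∸2k≡m n∸k≡1+m+r n∸1≡1+m+2r n∸2≡m+2r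
  where
  substitute : n ∸ 2 * suc r ≡ m → n ∸ suc r ≡ suc (m + r) →
               n ∸ 1 ≡ suc (m + r + r) → n ∸ 2 ≡ m + r + r →
               q₀ n (suc r) ≡ q r m ((m + r + r) C r) ((m + r) C r)
  substitute e₁ e₂ e₃ e₄ rewrite e₁ | e₂ | e₃ | e₄ = refl
  n≡1+m+r+k : n ≡ suc (m + r) + suc r
  n≡1+m+r+k = trans n≡2k+m (solve (r ∷ m ∷ []))
  n≡2+m+2r : n ≡ 2 + (m + r + r)
  n≡2+m+2r = trans n≡2k+m (solve (r ∷ m ∷ []))
  n∸2k≡m : n ∸ 2 * suc r ≡ m
  n∸2k≡m = trans (cong (_∸ 2 * suc r) n≡2k+m) (m+n∸m≡n (2 * suc r) m)
  n∸k≡1+m+r : n ∸ suc r ≡ suc (m + r)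
  n∸k≡1+m+r = trans (cong (_∸ suc r) n≡1+m+r+k) (m+n∸n≡m (suc (m + r)) (suc r))
  n∸1≡1+m+2r : n ∸ 1 ≡ suc (m + r + r)
  n∸1≡1+m+2r = cong (_∸ 1) n≡2+m+2r
  n∸2≡m+2r : n ∸ 2 ≡ m + r + r
  n∸2≡m+2r = cong (_∸ 2) n≡2+m+2r

-- The first fraction of q is below r and the second at most 2rmP / (1+r)².
q<P*m : ∀ r m A B P .{{_ : NonZero r}} .{{_ : NonZero m}} →
  2 ≤ B → 2 * suc r * A ≤ P * B → 2 + r ≤ P → q r m A B <ℤ + (P * m)
q<P*m r m A B@(suc (suc _)) P 2≤B@(s≤s (s≤s _)) 2[1+r]A≤PB 2+r≤P = floor[a/b+c/d]<N a b c d (P * m)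
  (a*d+c*b<N*[b*d] {c = c} {x = r} {y = suc r * suc r} {z = 2 * r * m * P} {N = P * m}
    a<r*b c*[1+r]²≤2rmP*d (r*[1+r]²+2*r*m*P≤P*m*[1+r]² r m P 2+r≤P))
  where
  open ≤-Reasoning
  a b c d : ℕ
  a = r * (m + 1)
  b = suc (m + r)
  c = r * m * suc (m + r + r) * (A ∸ B)
  d = suc r * suc (m + r) * (B ∸ 1)
  a<r*b : a < r * b
  a<r*b = *-monoʳ-< r (s≤s (+-monoʳ-≤ m (>-nonZero⁻¹ r)))
  1+m+2r≤2*b : suc (m + r + r) ≤ 2 * b
  1+m+2r≤2*b = begin
    suc (m + r + r)          ≤⟨ m≤m+n (suc (m + r + r)) (suc m) ⟩
    suc (m + r + r) + suc m  ≡⟨ solve (m ∷ r ∷ []) ⟩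
    2 * suc (m + r)          ∎
  scaled : ∀ {X Y} → suc r * X ≤ P * Y →
           r * m * suc (m + r + r) * X * (suc r * suc r) ≤ 2 * r * m * P * (suc r * suc (m + r) * Y)
  scaled {X} {Y} [1+r]X≤PY = begin
    r * m * suc (m + r + r) * X * (suc r * suc r)    ≡⟨ solve (r ∷ m ∷ X ∷ []) ⟩
    r * m * suc r * (suc (m + r + r) * (suc r * X))  ≤⟨ *-monoʳ-≤ (r * m * suc r) (*-mono-≤ 1+m+2r≤2*b [1+r]X≤PY) ⟩
    r * m * suc r * (2 * suc (m + r) * (P * Y))      ≡⟨ solve (r ∷ m ∷ P ∷ Y ∷ []) ⟩
    2 * r * m * P * (suc r * suc (m + r) * Y)        ∎
  c*[1+r]²≤2rmP*d : c * (suc r * suc r) ≤ 2 * r * m * P * d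
  c*[1+r]²≤2rmP*d = scaled (c*[A∸B]≤P*[B∸1] {suc r} {A} {B} {P} 2≤B 2[1+r]A≤PB)

proposition3p6 : (n k : ℕ) → 2 ≤ k → 2 * k + 1 ≤ n →
    q₀ n k <ℤ + (4 ^ k * (n ∸ 2 * k))
proposition3p6 n k@(suc r) (s≤s 1≤r) 2k+1≤n with m≤n⇒∃[o]m+o≡n 2k+1≤n
... | m , 2k+1+m≡n = begin-strict
  q₀ n k                   ≡⟨ q₀≡q r (suc m) n≡2k+[1+m] ⟩
  q r (suc m) A B          <⟨ q<P*m r (suc m) A B (4 ^ k) 2≤B
                                (2*[1+r]*[1+m+2r]Cr≤4^[1+r]*[1+m+r]Cr r m) (2+n≤4^[1+n] r) ⟩
  + (4 ^ k * suc m)        ≡⟨ cong (λ i → + (4 ^ k * i)) n∸2k≡1+m ⟨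
  + (4 ^ k * (n ∸ 2 * k))  ∎
  where
  open ℤ.≤-Reasoning
  instance
    r≢0 : NonZero r
    r≢0 = >-nonZero 1≤r
  A B : ℕ
  A = (suc m + r + r) C r
  B = (suc m + r) C r
  2≤B : 2 ≤ B
  2≤B = 2≤nCk 1≤r (m<n+m r z<s)
  n≡2k+[1+m] : n ≡ 2 * k + suc m
  n≡2k+[1+m] = trans (sym 2k+1+m≡n) (+-assoc (2 * k) 1 m)
  n∸2k≡1+m : n ∸ 2 * k ≡ suc m
  n∸2k≡1+m = trans (cong (_∸ 2 * k) n≡2k+[1+m]) (m+n∸m≡n (2 * k) (suc m))
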